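{- Let $G$ be a connected graph of order $n_1\ge 2$ and let $H$ be a graph of order $n_2$. Then $$pd(G\odot H)\le \frac{1}{n_1}\dim(G\odot H)+pd(G)+1.$$
   Context: All graphs are finite and simple; $d(u,v)$ is the length of a shortest $u$–$v$ path. For a connected graph $F$ and an ordered set $S=\{s_1,\dots,s_k\}$ of vertices, $r(v|S)=(d(v,s_1),\dots,d(v,s_k))$; $S$ is a resolving set if $r(u|S)\neq r(v|S)$ for all distinct vertices $u,v$; the metric dimension $\dim(F)$ is the minimum cardinality of a resolving set. For an ordered partition $\Pi=\{P_1,\dots,P_t\}$ of $V(F)$, $r(v|\Pi)=(d(v,P_1),\dots,d(v,P_t))$ where $d(v,P_i)=\min_{u\in P_i}d(v,u)$; $\Pi$ is a resolving partition if $r(u|\Pi)\ne r(v|\Pi)$ for all distinct vertices $u,v$; the partition dimension $pd(F)$ is the minimum number of sets in a resolving partition. For graphs $G$ of order $n_1$ (vertices $v_1,\dots,v_{n_1}$) and $H$, the corona product $G\odot H$ is obtained from one copy of $G$ and $n_1$ copies $H_1,\dots,H_{n_1}$ of $H$ by joining $v_i$ by an edge to every vertex of $H_i$. -}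

module Defs where

open import Data.Nat using (ℕ; zero; suc; _≤_)
open import Data.Fin using (Fin)
open import Data.Product using (Σ; ∃; _×_; _,_; proj₁; proj₂)
open import Data.Sum using (_⊎_; inj₁; inj₂)
open import Relation.Binary.PropositionalEquality using (_≡_; refl; sym)
open import Relation.Nullary using (¬_)

record Graph (V : Set) : Set₁ where
  field
    Adj        : V → V → Set
    adj-sym    : ∀ {u v} → Adj u v → Adj v u
    adj-irrefl : ∀ {v} → ¬ Adj v v

module _ {V : Set} (F : Graph V) where
  open Graph F

  data Walk : V → V → ℕ → Set where
    here : ∀ {v} → Walk v v 0
    step : ∀ {u w v k} → Adj u w → Walk w v k → Walk u v (suc k)

  Connected : Set
  Connected = ∀ u v → ∃ λ k → Walk u v k

  IsDist : V → V → ℕ → Set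
  IsDist u v k = Walk u v k × (∀ m → Walk u v m → k ≤ m)

  Distinct : ∀ {k} → (Fin k → V) → Set
  Distinct S = ∀ {a b} → S a ≡ S b → a ≡ b

  SameRepSet : ∀ {k} → (Fin k → V) → V → V → Set
  SameRepSet S u v = ∀ j d → (IsDist u (S j) d → IsDist v (S j) d)
                           × (IsDist v (S j) d → IsDist u (S j) d)

  IsResolvingSet : ∀ {k} → (Fin k → V) → Set
  IsResolvingSet S = ∀ u v → SameRepSet S u v → u ≡ v

  HasResolvingSetOfSize : ℕ → Set
  HasResolvingSetOfSize k = Σ (Fin k → V) λ S → Distinct S × IsResolvingSet S

  IsMetricDim : ℕ → Set
  IsMetricDim k = HasResolvingSetOfSize k × (∀ m → HasResolvingSetOfSize m → k ≤ m)

  -- an ordered partition {P_1,…,P_t} given by the class map f (P_i = f⁻¹(i)),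
  -- all classes nonempty
  AllClassesNonempty : ∀ {t} → (V → Fin t) → Set
  AllClassesNonempty f = ∀ i → ∃ λ u → f u ≡ i

  IsDistToClass : ∀ {t} → (V → Fin t) → V → Fin t → ℕ → Set
  IsDistToClass f v i d =
    (∃ λ u → f u ≡ i × IsDist v u d)
    × (∀ u e → f u ≡ i → IsDist v u e → d ≤ e)

  SameRepPart : ∀ {t} → (V → Fin t) → V → V → Set
  SameRepPart f u v = ∀ i d → (IsDistToClass f u i d → IsDistToClass f v i d)
                            × (IsDistToClass f v i d → IsDistToClass f u i d)

  IsResolvingPartition : ∀ {t} → (V → Fin t) → Set
  IsResolvingPartition f = ∀ u v → SameRepPart f u v → u ≡ v

  HasResolvingPartitionOfSize : ℕ → Set
  HasResolvingPartitionOfSize t =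
    Σ (V → Fin t) λ f → AllClassesNonempty f × IsResolvingPartition f

  IsPartitionDim : ℕ → Set
  IsPartitionDim p = HasResolvingPartitionOfSize p
                     × (∀ q → HasResolvingPartitionOfSize q → p ≤ q)

-- Corona product G ⊙ H: vertices inj₁ i (v_i of G) and inj₂ (i , x)
-- (vertex x of the copy H_i).
module _ {n₁ n₂ : ℕ} (G : Graph (Fin n₁)) (H : Graph (Fin n₂)) where
  private
    module G = Graph G
    module H = Graph H

  CV : Set
  CV = Fin n₁ ⊎ (Fin n₁ × Fin n₂)

  CAdj : CV → CV → Set
  CAdj (inj₁ a) (inj₁ b) = G.Adj a b
  CAdj (inj₁ a) (inj₂ (i , x)) = a ≡ i
  CAdj (inj₂ (i , x)) (inj₁ a) = i ≡ a
  CAdj (inj₂ (i , x)) (inj₂ (j , y)) = i ≡ j × H.Adj x y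

  private
    csym : ∀ {u v} → CAdj u v → CAdj v u
    csym {inj₁ a} {inj₁ b} e = G.adj-sym e
    csym {inj₁ a} {inj₂ _} e = sym e
    csym {inj₂ _} {inj₁ a} e = sym e
    csym {inj₂ _} {inj₂ _} (e , h) = sym e , H.adj-sym h

    cirr : ∀ {v} → ¬ CAdj v v
    cirr {inj₁ a} e = G.adj-irrefl e
    cirr {inj₂ _} (_ , h) = H.adj-irrefl h

  corona : Graph CV
  corona = record { Adj = CAdj ; adj-sym = λ {u} {v} → csym {u} {v} ; adj-irrefl = λ {v} → cirr {v} }

module Submission where

-- Let S = (s₁,…,s_d) be a metric basis of G ⊙ H and fG a resolving partition
-- of G with q classes.  Every s_j lies in at most one copy H_i, so
-- Σ_i |S ∩ H_i| ≤ d and some copy H_{i₀} satisfies n₁·|S ∩ H_{i₀}| ≤ d.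
-- Label the corona as follows: v_a gets the class fG(a); a copy vertex (i,x)
-- gets the label j when (i₀,x) = s_j, and one extra label ⋆ otherwise.  This
-- labelling resolves G ⊙ H: distances to the G-classes are
-- height(u) + d_G(base(u), ·), so fG separates vertices over different bases;
-- two ⋆-vertices of one copy see the same members of S ∩ H_{i₀} at distance 1,
-- hence (i₀,x) and (i₀,y) have the same S-representation and x = y.
-- Discarding empty labels gives a resolving partition with at most
-- q + 1 + |S ∩ H_{i₀}| classes, and multiplying by n₁ proves the claim.

open import Defs
open import Data.Nat using (ℕ; zero; suc; _≤_; _+_; _*_; z≤n; s≤s)
open import Data.Nat.Properties
open import Data.Bool using (Bool; true; false; T)
open import Data.Unit using (⊤; tt)
open import Data.Empty using (⊥-elim)
open import Data.Fin using (Fin; zero; suc; _↑ˡ_; _↑ʳ_; splitAt)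
open import Data.Fin.Properties
  using (↑ʳ-injective; ↑ˡ-injective; splitAt-↑ˡ; splitAt-↑ʳ; any?)
  renaming (_≟_ to _≟ᶠ_; suc-injective to fsuc-injective)
open import Data.Product using (∃; _×_; _,_; proj₁; proj₂)
open import Data.Product.Properties using () renaming (≡-dec to ×-≡-dec)
open import Data.Sum using (_⊎_; inj₁; inj₂)
open import Data.Sum.Properties using () renaming (≡-dec to ⊎-≡-dec)
open import Function using (_∘_)
open import Relation.Binary.PropositionalEquality hiding ([_])
open import Relation.Nullary using (¬_; Dec; yes; no; does; isYes)
open import Relation.Nullary.Decidable using (toWitness; fromWitness; dec-true)
open import Algebra.Properties.CommutativeMonoid.Sum +-0-commutativeMonoid
  using (sum; sum-syntax; ∑-comm; sum-replicate-zero)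

-- D is the least length at which the family A is inhabited; for
-- A = Walk F u v this is exactly IsDist F u v D.
Shortest : (ℕ → Set) → ℕ → Set
Shortest A D = A D × (∀ m → A m → D ≤ m)

module ShiftedShortest (A B : ℕ → Set) (c : ℕ)
  (extend : ∀ k → A k → B (c + k))
  (shorten : ∀ k → B k → ∃ λ m → c + m ≤ k × A m) where

  shift : ∀ D → Shortest A D → Shortest B (c + D)
  shift D (a , least) = extend D a , λ k b →
    let (m , c+m≤k , a′) = shorten k b in ≤-trans (+-monoʳ-≤ c (least m a′)) c+m≤k

  unshift : ∀ E → Shortest B E → ∃ λ D → E ≡ c + D × Shortest A D
  unshift E (b , least) with shorten E b
  ... | m , c+m≤E , a =
    m , ≤-antisym (least (c + m) (extend m a)) c+m≤E ,
    (a , λ k a′ → +-cancelˡ-≤ c m k (≤-trans c+m≤E (least (c + k) (extend k a′))))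

∑-≤-const : ∀ {n c} (f : Fin n → ℕ) → (∀ i → f i ≤ c) → sum f ≤ n * c
∑-≤-const {zero} f f≤c = z≤n
∑-≤-const {suc n} f f≤c = +-mono-≤ (f≤c zero) (∑-≤-const (f ∘ suc) (f≤c ∘ suc))

∑-≥-const : ∀ {n c} (f : Fin n → ℕ) → (∀ i → c ≤ f i) → n * c ≤ sum f
∑-≥-const {zero} f c≤f = z≤n
∑-≥-const {suc n} f c≤f = +-mono-≤ (c≤f zero) (∑-≥-const (f ∘ suc) (c≤f ∘ suc))

∑-mono-≤ : ∀ {n} (f g : Fin n → ℕ) → (∀ i → f i ≤ g i) → sum f ≤ sum g
∑-mono-≤ {zero} f g f≤g = z≤n
∑-mono-≤ {suc n} f g f≤g =
  +-mono-≤ (f≤g zero) (∑-mono-≤ (f ∘ suc) (g ∘ suc) (f≤g ∘ suc))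

∑-split : ∀ a {c} (f : Fin (a + c) → ℕ) →
  sum f ≡ sum (f ∘ (_↑ˡ c)) + sum (f ∘ (a ↑ʳ_))
∑-split zero f = refl
∑-split (suc a) f =
  trans (cong (f zero +_) (∑-split a (f ∘ suc))) (sym (+-assoc (f zero) _ _))

argmin : ∀ {n} (f : Fin (suc n) → ℕ) → ∃ λ i → ∀ j → f i ≤ f j
argmin {zero} f = zero , λ { zero → ≤-refl }
argmin {suc n} f with argmin (f ∘ suc)
... | i , minimal with f zero ≤? f (suc i)
...   | yes f0≤ = zero , λ { zero → ≤-refl ; (suc j) → ≤-trans f0≤ (minimal j) }
...   | no f0≰ = suc i , λ { zero → ≰⇒≥ f0≰ ; (suc j) → minimal j }

[_] : Bool → ℕ
[ true ] = 1
[ false ] = 0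

count : ∀ {t} → (Fin t → Bool) → ℕ
count {t} b = ∑[ i < t ] [ b i ]

[_]≤1 : ∀ x → [ x ] ≤ 1
[ true ]≤1 = ≤-refl
[ false ]≤1 = z≤n

count≤ : ∀ {t} (b : Fin t → Bool) → count b ≤ t
count≤ {t} b = ≤-trans (∑-≤-const _ (λ i → [ b i ]≤1)) (≤-reflexive (*-identityʳ t))

count-mono : ∀ {t} (b b′ : Fin t → Bool) →
  (∀ i → T (b i) → T (b′ i)) → count b ≤ count b′
count-mono b b′ b⇒b′ = ∑-mono-≤ _ _ λ i → indicator-mono (b i) (b′ i) (b⇒b′ i)
  where
    indicator-mono : ∀ x y → (T x → T y) → [ x ] ≤ [ y ]
    indicator-mono true true _ = ≤-refl
    indicator-mono true false x⇒y = ⊥-elim (x⇒y tt)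
    indicator-mono false y _ = z≤n

∑-single : ∀ {n} (a : Fin n) → ∑[ i < n ] [ does (a ≟ᶠ i) ] ≡ 1
∑-single {suc n} zero = cong suc (sum-replicate-zero n)
∑-single {suc n} (suc a) = ∑-single a

record Enumeration {t} (b : Fin t → Bool) (m : ℕ) : Set where
  field
    label           : Fin m → Fin t
    label-selected  : ∀ k → T (b (label k))
    label-injective : ∀ {k l} → label k ≡ label l → k ≡ l
    label-onto      : ∀ i → T (b i) → ∃ λ k → label k ≡ i

enumerate : ∀ {t} (b : Fin t → Bool) → Enumeration b (count b)
enumerate {zero} b = record
  { label = λ () ; label-selected = λ () ; label-injective = λ { {()} } ; label-onto = λ () }
enumerate {suc t} b with b zero in b0
... | true = record
  { label = keep ; label-selected = keep-selected
  ; label-injective = keep-injective ; label-onto = keep-onto }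
  where
    open Enumeration (enumerate (b ∘ suc))
    keep : Fin (suc (count (b ∘ suc))) → Fin (suc t)
    keep zero = zero
    keep (suc k) = suc (label k)
    keep-selected : ∀ k → T (b (keep k))
    keep-selected zero = subst T (sym b0) tt
    keep-selected (suc k) = label-selected k
    keep-injective : ∀ {k l} → keep k ≡ keep l → k ≡ l
    keep-injective {zero} {zero} _ = refl
    keep-injective {suc k} {suc l} eq = cong suc (label-injective (fsuc-injective eq))
    keep-onto : ∀ i → T (b i) → ∃ λ k → keep k ≡ i
    keep-onto zero _ = zero , refl
    keep-onto (suc i) bi = let (k , eq) = label-onto i bi in suc k , cong suc eq
... | false = record
  { label = suc ∘ label ; label-selected = label-selected
  ; label-injective = label-injective ∘ fsuc-injective ; label-onto = skip-onto }
  where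
    open Enumeration (enumerate (b ∘ suc))
    skip-onto : ∀ i → T (b i) → ∃ λ k → suc (label k) ≡ i
    skip-onto zero b0-true = ⊥-elim (subst T b0 b0-true)
    skip-onto (suc i) bi = let (k , eq) = label-onto i bi in k , cong suc eq

walk-length-zero : ∀ {V} {F : Graph V} {u v} → Walk F u v 0 → u ≡ v
walk-length-zero here = refl

module _ {V : Set} (F : Graph V) where

  -- Every vertex lies at distance 0 from its own class, so vertices with the
  -- same representation lie in the same class.
  own-class : ∀ {t} (f : V → Fin t) u → IsDistToClass F f u (f u) 0
  own-class f u = (u , refl , (here , λ _ _ → z≤n)) , λ _ _ _ _ → z≤n

  same-rep⇒same-class : ∀ {t} (f : V → Fin t) {u v} → SameRepPart F f u v → f u ≡ f v
  same-rep⇒same-class f {u} same with proj₁ (same (f u) 0) (own-class f u)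
  ... | (w , fw≡fu , (walk , _)) , _ = trans (sym fw≡fu) (cong f (sym (walk-length-zero walk)))

  swap-rep : ∀ {t} (f : V → Fin t) {u v} → SameRepPart F f u v → SameRepPart F f v u
  swap-rep f same k D = proj₂ (same k D) , proj₁ (same k D)

  -- Renaming the labels of a resolving labelling along an injection keeps it
  -- resolving: the class k of f′ is the class e k of f.
  rename-resolving : ∀ {t m} (f : V → Fin t) (e : Fin m → Fin t) (f′ : V → Fin m) →
    (∀ {k l} → e k ≡ e l → k ≡ l) → (∀ u → e (f′ u) ≡ f u) →
    IsResolvingPartition F f → IsResolvingPartition F f′
  rename-resolving f e f′ e-injective e∘f′ f-resolving u v same′ =
    f-resolving u v λ c D → transfer same′ c D , transfer (swap-rep f′ same′) c D
    where
      in-class : ∀ w k → f w ≡ e k → f′ w ≡ k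
      in-class w k fw = e-injective (trans (e∘f′ w) fw)
      to-f : ∀ x k D → IsDistToClass F f′ x k D → IsDistToClass F f x (e k) D
      to-f x k D ((w , f′w , dw) , least) =
        (w , trans (sym (e∘f′ w)) (cong e f′w) , dw) ,
        λ w′ D′ fw′ dw′ → least w′ D′ (in-class w′ k fw′) dw′
      from-f : ∀ x k D → IsDistToClass F f x (e k) D → IsDistToClass F f′ x k D
      from-f x k D ((w , fw , dw) , least) =
        (w , in-class w k fw , dw) ,
        λ w′ D′ f′w′ dw′ → least w′ D′ (trans (sym (e∘f′ w′)) (cong e f′w′)) dw′
      -- a nonempty class c of f is the class e (f′ w) for any of its members w
      transfer : ∀ {x y} → SameRepPart F f′ x y → ∀ c D →
        IsDistToClass F f x c D → IsDistToClass F f y c D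
      transfer {x} {y} s c D h@((w , fw , _) , _) =
        subst (λ c′ → IsDistToClass F f y c′ D) eq
          (to-f y (f′ w) D (proj₁ (s (f′ w) D)
            (from-f x (f′ w) D (subst (λ c′ → IsDistToClass F f x c′ D) (sym eq) h))))
        where
          eq : e (f′ w) ≡ c
          eq = trans (e∘f′ w) fw

  drop-empty-classes : ∀ {t} (f : V → Fin t) (inhabited? : ∀ c → Dec (∃ λ u → f u ≡ c)) →
    IsResolvingPartition F f →
    HasResolvingPartitionOfSize F (count (isYes ∘ inhabited?))
  drop-empty-classes f inhabited? f-resolving =
    f′ , nonempty , rename-resolving f label f′ label-injective e∘f′ f-resolving
    where
      open Enumeration (enumerate (isYes ∘ inhabited?))
      position : ∀ u → ∃ λ k → label k ≡ f u
      position u = label-onto (f u) (fromWitness (u , refl))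
      f′ : V → Fin (count (isYes ∘ inhabited?))
      f′ = proj₁ ∘ position
      e∘f′ : ∀ u → label (f′ u) ≡ f u
      e∘f′ = proj₂ ∘ position
      nonempty : AllClassesNonempty F f′
      nonempty k = let (u , fu) = toWitness (label-selected k) in
        u , label-injective (trans (e∘f′ u) fu)

module CoronaDistances {n₁ n₂ : ℕ} (G : Graph (Fin n₁)) (H : Graph (Fin n₂)) where
  private
    module H = Graph H

  V : Set
  V = CV G H

  C : Graph V
  C = corona G H

  copy-injective : ∀ {i i′ x y} → _≡_ {A = V} (inj₂ (i , x)) (inj₂ (i′ , y)) → x ≡ y
  copy-injective refl = refl

  base : V → Fin n₁
  base (inj₁ a) = a
  base (inj₂ (i , _)) = i

  height : V → ℕ
  height (inj₁ _) = 0
  height (inj₂ _) = 1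

  edge-base : ∀ u w → Graph.Adj C u w → Graph.Adj G (base u) (base w) ⊎ base u ≡ base w
  edge-base (inj₁ a) (inj₁ b) e = inj₁ e
  edge-base (inj₁ a) (inj₂ _) e = inj₂ e
  edge-base (inj₂ _) (inj₁ b) e = inj₂ e
  edge-base (inj₂ _) (inj₂ _) (e , _) = inj₂ e

  lift : ∀ {a b k} → Walk G a b k → Walk C (inj₁ a) (inj₁ b) k
  lift here = here
  lift (step e w) = step e (lift w)

  project : ∀ {u a k} → Walk C u (inj₁ a) k → ∃ λ m → m ≤ k × Walk G (base u) a m
  project here = 0 , z≤n , here
  project (step {u = u} {w = w} e rest) with project rest | edge-base u w e
  ... | m , m≤k , walk | inj₁ g = suc m , s≤s m≤k , step g walk
  ... | m , m≤k , walk | inj₂ same =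
    m , m≤n⇒m≤1+n m≤k , subst (λ b → Walk G b _ m) (sym same) walk

  Outside : Fin n₁ → V → Set
  Outside i (inj₁ _) = ⊤
  Outside i (inj₂ (i′ , _)) = ¬ i′ ≡ i

  leave-copy : ∀ {i x t k} → Walk C (inj₂ (i , x)) t k → Outside i t →
    ∃ λ m → suc m ≤ k × Walk C (inj₁ i) t m
  leave-copy here out = ⊥-elim (out refl)
  leave-copy (step {w = inj₁ _} refl rest) out = _ , ≤-refl , rest
  leave-copy (step {w = inj₂ _} (refl , _) rest) out =
    let (m , m<k , walk) = leave-copy rest out in m , m≤n⇒m≤1+n m<k , walk

  climb : ∀ u {a k} → Walk G (base u) a k → Walk C u (inj₁ a) (height u + k)
  climb (inj₁ _) walk = lift walk
  climb (inj₂ _) walk = step refl (lift walk)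

  descend : ∀ u {a k} → Walk C u (inj₁ a) k → ∃ λ m → height u + m ≤ k × Walk G (base u) a m
  descend (inj₁ _) walk = project walk
  descend (inj₂ _) walk with leave-copy walk tt
  ... | m , m<k , walk′ =
    let (m′ , m′≤m , g) = project walk′ in m′ , ≤-trans (s≤s m′≤m) m<k , g

  -- d(u, v_a) = height u + d_G(base u, a).
  module ToG (u : V) (a : Fin n₁) = ShiftedShortest
    (Walk G (base u) a) (Walk C u (inj₁ a)) (height u) (λ _ → climb u) (λ _ → descend u)

  -- d((i,x), t) = 1 + d(v_i, t) for t outside H_i; in particular all vertices
  -- of H_i are at the same distance from t.
  module FromCopy (i : Fin n₁) (x : Fin n₂) (t : V) (out : Outside i t) = ShiftedShortest
    (Walk C (inj₁ i) t) (Walk C (inj₂ (i , x)) t) 1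
    (λ _ → step refl) (λ _ walk → leave-copy walk out)

  copy-equidistant-outside : ∀ {i} x y {t} → Outside i t → ∀ E →
    IsDist C (inj₂ (i , x)) t E → IsDist C (inj₂ (i , y)) t E
  copy-equidistant-outside {i} x y {t} out E dist with FromCopy.unshift i x t out E dist
  ... | D , refl , dist′ = FromCopy.shift i y t out D dist′

  one-step-adjacent : ∀ {i i′ x z} → Walk C (inj₂ (i , x)) (inj₂ (i′ , z)) 1 → H.Adj x z
  one-step-adjacent (step {w = inj₂ _} (_ , adj) here) = adj

  via-base : ∀ {i x z} → Walk C (inj₂ (i , x)) (inj₂ (i , z)) 2
  via-base {i} = step {w = inj₁ i} refl (step refl here)

  dist-adjacent : ∀ {i x z} → H.Adj x z → IsDist C (inj₂ (i , x)) (inj₂ (i , z)) 1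
  dist-adjacent adj = step (refl , adj) here , λ
    { zero walk → ⊥-elim (H.adj-irrefl
        (subst (λ y → H.Adj y _) (copy-injective (walk-length-zero walk)) adj))
    ; (suc _) _ → s≤s z≤n }

  dist-nonadjacent : ∀ {i x z} → ¬ x ≡ z → ¬ H.Adj x z →
    IsDist C (inj₂ (i , x)) (inj₂ (i , z)) 2
  dist-nonadjacent x≢z ¬adj = via-base , λ
    { zero walk → ⊥-elim (x≢z (copy-injective (walk-length-zero walk)))
    ; (suc zero) walk → ⊥-elim (¬adj (one-step-adjacent walk))
    ; (suc (suc _)) _ → s≤s (s≤s z≤n) }

  copy-twins : ∀ {i x y z} → ¬ x ≡ z → ¬ y ≡ z →
    (H.Adj x z → H.Adj y z) → (H.Adj y z → H.Adj x z) →
    ∀ E → IsDist C (inj₂ (i , x)) (inj₂ (i , z)) E → IsDist C (inj₂ (i , y)) (inj₂ (i , z)) E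
  copy-twins x≢z y≢z x⇒y y⇒x zero (walk , _) =
    ⊥-elim (x≢z (copy-injective (walk-length-zero walk)))
  copy-twins x≢z y≢z x⇒y y⇒x 1 (walk , _) = dist-adjacent (x⇒y (one-step-adjacent walk))
  copy-twins x≢z y≢z x⇒y y⇒x 2 (_ , least) =
    dist-nonadjacent y≢z λ adj → 1+n≰n (least 1 (step (refl , y⇒x adj) here))
  copy-twins x≢z y≢z x⇒y y⇒x (suc (suc (suc _))) (_ , least) with least 2 via-base
  ... | s≤s (s≤s ())

  inCopy : Fin n₁ → V → Bool
  inCopy i (inj₁ _) = false
  inCopy i (inj₂ (i′ , _)) = does (i′ ≟ᶠ i)

  in-at-most-one-copy : ∀ t → ∑[ i < n₁ ] [ inCopy i t ] ≤ 1
  in-at-most-one-copy (inj₁ _) = ≤-trans (≤-reflexive (sum-replicate-zero n₁)) z≤n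
  in-at-most-one-copy (inj₂ (i′ , _)) = ≤-reflexive (∑-single i′)

  _≟ᵛ_ : (u v : V) → Dec (u ≡ v)
  _≟ᵛ_ = ⊎-≡-dec _≟ᶠ_ (×-≡-dec _≟ᶠ_ _≟ᶠ_)

  any-vertex? : {P : V → Set} → (∀ v → Dec (P v)) → Dec (∃ P)
  any-vertex? P? with any? (P? ∘ inj₁) | any? (λ i → any? (λ x → P? (inj₂ (i , x))))
  ... | yes (a , p) | _ = yes (inj₁ a , p)
  ... | no _ | yes (i , x , p) = yes (inj₂ (i , x) , p)
  ... | no ¬G | no ¬copies = no λ
    { (inj₁ a , p) → ¬G (a , p) ; (inj₂ (i , x) , p) → ¬copies (i , x , p) }

module CoronaLabelling {n₁ n₂ q d : ℕ} (G : Graph (Fin n₁)) (H : Graph (Fin n₂))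
  (fG : Fin n₁ → Fin q) (fG-resolving : IsResolvingPartition G fG)
  (S : Fin d → CV G H) (S-distinct : Distinct (corona G H) S)
  (S-resolving : IsResolvingSet (corona G H) S) (i₀ : Fin n₁) where

  open CoronaDistances G H
  private
    module H = Graph H

  InBasis : Fin n₂ → Set
  InBasis x = ∃ λ j → S j ≡ inj₂ (i₀ , x)

  inBasis? : ∀ x → Dec (InBasis x)
  inBasis? x = any? (λ j → S j ≟ᵛ inj₂ (i₀ , x))

  copyLabel : ∀ x → Dec (InBasis x) → Fin (suc d)
  copyLabel x (yes (j , _)) = suc j
  copyLabel x (no _) = zero

  label : V → Fin (q + suc d)
  label (inj₁ a) = fG a ↑ˡ suc d
  label (inj₂ (_ , x)) = q ↑ʳ copyLabel x (inBasis? x)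

  copyLabel-suc : ∀ {x j} p → copyLabel x p ≡ suc j → S j ≡ inj₂ (i₀ , x)
  copyLabel-suc (yes (_ , sj)) refl = sj

  copyLabel-basis : ∀ {x j} p → S j ≡ inj₂ (i₀ , x) → copyLabel x p ≡ suc j
  copyLabel-basis (yes (_ , sj′)) sj = cong suc (S-distinct (trans sj′ (sym sj)))
  copyLabel-basis (no x∉) sj = ⊥-elim (x∉ (_ , sj))

  copyLabel-star : ∀ {x} p → ¬ InBasis x → copyLabel x p ≡ zero
  copyLabel-star (yes x∈) x∉ = ⊥-elim (x∉ x∈)
  copyLabel-star (no _) _ = refl

  G≢copy : ∀ {a b} → ¬ (a ↑ˡ suc d ≡ q ↑ʳ b)
  G≢copy {a} {b} eq with trans (sym (splitAt-↑ˡ q a (suc d)))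
                          (trans (cong (splitAt q) eq) (splitAt-↑ʳ q (suc d) b))
  ... | ()

  SameRep : V → V → Set
  SameRep = SameRepPart C label

  same-label : ∀ {u v} → SameRep u v → label u ≡ label v
  same-label = same-rep⇒same-class C label

  G-class : ∀ u m D → IsDistToClass G fG (base u) m D →
    IsDistToClass C label u (m ↑ˡ suc d) (height u + D)
  G-class u m D ((a , fa , dist) , least) =
    (inj₁ a , cong (_↑ˡ suc d) fa , ToG.shift u a D dist) , lower
    where
      lower : ∀ w E → label w ≡ m ↑ˡ suc d → IsDist C u w E → height u + D ≤ E
      lower (inj₁ a′) E fa′ dist′ with ToG.unshift u a′ E dist′
      ... | D′ , refl , distG =
        +-monoʳ-≤ (height u) (least a′ D′ (↑ˡ-injective (suc d) _ _ fa′) distG)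
      lower (inj₂ _) E eq _ = ⊥-elim (G≢copy (sym eq))

  G-class⁻¹ : ∀ u m E → IsDistToClass C label u (m ↑ˡ suc d) E →
    ∃ λ D → E ≡ height u + D × IsDistToClass G fG (base u) m D
  G-class⁻¹ u m E ((inj₂ _ , eq , _) , _) = ⊥-elim (G≢copy (sym eq))
  G-class⁻¹ u m E ((inj₁ a , fa , dist) , least) with ToG.unshift u a E dist
  ... | D , refl , distG = D , refl , ((a , ↑ˡ-injective (suc d) _ _ fa , distG) ,
    λ a′ D′ fa′ dist′ → +-cancelˡ-≤ (height u) _ _
      (least (inj₁ a′) (height u + D′) (cong (_↑ˡ suc d) fa′) (ToG.shift u a′ D′ dist′)))

  same-base-rep : ∀ u v → height u ≡ height v → SameRep u v →
    SameRepPart G fG (base u) (base v)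
  same-base-rep u v eq same m D = transport u v eq same , transport v u (sym eq) (swap-rep C label same)
    where
      transport : ∀ u v → height u ≡ height v → SameRep u v →
        IsDistToClass G fG (base u) m D → IsDistToClass G fG (base v) m D
      transport u v eq same h
        with G-class⁻¹ v m _ (proj₁ (same (m ↑ˡ suc d) (height u + D)) (G-class u m D h))
      ... | D′ , E≡ , h′ = subst (IsDistToClass G fG (base v) m)
        (sym (+-cancelˡ-≡ (height u) D D′ (trans E≡ (cong (_+ D′) (sym eq))))) h′

  -- A ⋆-vertex (i,x) adjacent to a basis vertex z of the chosen copy is at
  -- distance 1 from the class of z; a vertex (i,y) with the same
  -- representation must therefore be adjacent to z as well.
  adjacency-to-basis : ∀ {i x y} → SameRep (inj₂ (i , x)) (inj₂ (i , y)) → ¬ InBasis x →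
    ∀ {j z} → S j ≡ inj₂ (i₀ , z) → H.Adj x z → H.Adj y z
  adjacency-to-basis {i} {x} {y} same x∉ {j} {z} sj adj = adjacent-y (proj₁ (same c 1) dist-x)
    where
      c : Fin (q + suc d)
      c = q ↑ʳ suc j
      x-outside : ¬ label (inj₂ (i , x)) ≡ c
      x-outside eq
        with ↑ʳ-injective q _ _ (trans (sym (cong (q ↑ʳ_) (copyLabel-star (inBasis? x) x∉))) eq)
      ... | ()
      dist-x : IsDistToClass C label (inj₂ (i , x)) c 1
      dist-x = (inj₂ (i , z) , cong (q ↑ʳ_) (copyLabel-basis (inBasis? z) sj) , dist-adjacent adj) ,
        λ { w zero lw (walk , _) → ⊥-elim (x-outside (trans (cong label (walk-length-zero walk)) lw))
          ; w (suc _) _ _ → s≤s z≤n }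
      adjacent-y : IsDistToClass C label (inj₂ (i , y)) c 1 → H.Adj y z
      adjacent-y ((inj₁ _ , eq , _) , _) = ⊥-elim (G≢copy eq)
      adjacent-y ((inj₂ (_ , z′) , eq , (walk , _)) , _) =
        subst (H.Adj y) (copy-injective (trans (sym z′-basis) sj)) (one-step-adjacent walk)
        where
          z′-basis : S j ≡ inj₂ (i₀ , z′)
          z′-basis = copyLabel-suc (inBasis? z′) (↑ʳ-injective q _ _ eq)

  basis-distances : ∀ {x y} → ¬ InBasis x → ¬ InBasis y →
    (∀ {j z} → S j ≡ inj₂ (i₀ , z) → H.Adj x z → H.Adj y z) →
    (∀ {j z} → S j ≡ inj₂ (i₀ , z) → H.Adj y z → H.Adj x z) →
    ∀ j E → IsDist C (inj₂ (i₀ , x)) (S j) E → IsDist C (inj₂ (i₀ , y)) (S j) E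
  basis-distances {x} {y} x∉ y∉ x⇒y y⇒x j E with S j in sj
  ... | inj₁ a = copy-equidistant-outside x y tt E
  ... | inj₂ (i , z) with i ≟ᶠ i₀
  ...   | no i≢i₀ = copy-equidistant-outside x y i≢i₀ E
  ...   | yes refl = copy-twins (λ { refl → x∉ (j , sj) }) (λ { refl → y∉ (j , sj) })
                       (x⇒y sj) (y⇒x sj) E

  star-twins-equal : ∀ {i x y} → SameRep (inj₂ (i , x)) (inj₂ (i , y)) →
    ¬ InBasis x → ¬ InBasis y → x ≡ y
  star-twins-equal {x = x} {y} same x∉ y∉ =
    copy-injective (S-resolving (inj₂ (i₀ , x)) (inj₂ (i₀ , y)) λ j E →
      basis-distances x∉ y∉ x⇒y y⇒x j E , basis-distances y∉ x∉ y⇒x x⇒y j E)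
    where
      x⇒y = adjacency-to-basis same x∉
      y⇒x = adjacency-to-basis (swap-rep C label same) y∉

  -- Two vertices of one copy with the same representation coincide: equal
  -- basis labels name the same s_j, and ⋆-vertices are handled above.
  same-copy-vertex : ∀ {i x y} → SameRep (inj₂ (i , x)) (inj₂ (i , y)) → x ≡ y
  same-copy-vertex {x = x} {y} same =
    from-labels (inBasis? x) (inBasis? y) (↑ʳ-injective q _ _ (same-label same))
    where
      from-labels : (px : Dec (InBasis x)) (py : Dec (InBasis y)) →
        copyLabel x px ≡ copyLabel y py → x ≡ y
      from-labels (yes (j , sj)) (yes (j′ , sj′)) eq =
        copy-injective (trans (sym sj) (trans (cong S (fsuc-injective eq)) sj′))
      from-labels (no x∉) (no y∉) _ = star-twins-equal same x∉ y∉
      from-labels (yes _) (no _) ()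
      from-labels (no _) (yes _) ()

  label-resolving : IsResolvingPartition C label
  label-resolving (inj₁ a) (inj₁ b) same = cong inj₁ (fG-resolving a b (same-base-rep _ _ refl same))
  label-resolving (inj₁ a) (inj₂ _) same = ⊥-elim (G≢copy (same-label same))
  label-resolving (inj₂ _) (inj₁ b) same = ⊥-elim (G≢copy (sym (same-label same)))
  label-resolving (inj₂ (i , x)) (inj₂ (i′ , y)) same
    with fG-resolving i i′ (same-base-rep _ _ refl same)
  ... | refl = cong (λ z → inj₂ (i , z)) (same-copy-vertex same)

  basisInCopy : ℕ
  basisInCopy = count (λ j → inCopy i₀ (S j))

  inhabited? : ∀ c → Dec (∃ λ u → label u ≡ c)
  inhabited? c = any-vertex? (λ u → label u ≟ᶠ c)

  -- Only the q labels of G, the label ⋆ and the labels of S ∩ H_{i₀} can be inhabited.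
  inhabited-labels : count (isYes ∘ inhabited?) ≤ q + (1 + basisInCopy)
  inhabited-labels = ≤-trans (≤-reflexive (∑-split q _))
    (+-mono-≤ (count≤ _) (+-mono-≤ [ _ ]≤1 (count-mono _ _ basis-label)))
    where
      basis-label : ∀ j → T (isYes (inhabited? (q ↑ʳ suc j))) → T (inCopy i₀ (S j))
      basis-label j h with toWitness h
      ... | inj₁ _ , eq = ⊥-elim (G≢copy eq)
      ... | inj₂ (_ , x) , eq rewrite copyLabel-suc (inBasis? x) (↑ʳ-injective q _ _ eq) =
        subst T (sym (dec-true (i₀ ≟ᶠ i₀) refl)) tt

  resolving-partition : HasResolvingPartitionOfSize C (count (isYes ∘ inhabited?))
  resolving-partition = drop-empty-classes C label inhabited? label-resolving

-- Every basis vertex lies in at most one copy, so Σ_i |S ∩ H_i| ≤ d.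
copies-share-basis : ∀ {n₁ n₂ d} (G : Graph (Fin n₁)) (H : Graph (Fin n₂))
  (S : Fin d → CV G H) →
  ∑[ i < n₁ ] count (λ j → CoronaDistances.inCopy G H i (S j)) ≤ d
copies-share-basis {n₁} {d = d} G H S = begin
  ∑[ i < n₁ ] ∑[ j < d ] [ inCopy i (S j) ] ≡⟨ ∑-comm (λ i j → [ inCopy i (S j) ]) ⟩
  ∑[ j < d ] ∑[ i < n₁ ] [ inCopy i (S j) ] ≤⟨ ∑-≤-const _ (in-at-most-one-copy ∘ S) ⟩
  d * 1                                    ≡⟨ *-identityʳ d ⟩
  d                                        ∎
  where
    open CoronaDistances G H
    open ≤-Reasoning

theorem2 : (n₁ n₂ : ℕ) (G : Graph (Fin n₁)) (H : Graph (Fin n₂)) →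
    2 ≤ n₁ → Connected G →
    (p d q : ℕ) →
    IsPartitionDim (corona G H) p → IsMetricDim (corona G H) d →
    IsPartitionDim G q →
    n₁ * p ≤ d + n₁ * (q + 1)
theorem2 zero _ _ _ ()
theorem2 (suc n) n₂ G H _ _ p d q (_ , p-minimal) ((S , S-distinct , S-resolving) , _)
         ((fG , _ , fG-resolving) , _) = begin
  N * p                              ≤⟨ *-monoʳ-≤ N (p-minimal _ resolving-partition) ⟩
  N * count (isYes ∘ inhabited?)     ≤⟨ *-monoʳ-≤ N inhabited-labels ⟩
  N * (q + (1 + basisInCopy))        ≡⟨ cong (N *_) (sym (+-assoc q 1 basisInCopy)) ⟩
  N * (q + 1 + basisInCopy)          ≡⟨ *-distribˡ-+ N (q + 1) basisInCopy ⟩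
  N * (q + 1) + N * basisInCopy      ≤⟨ +-monoʳ-≤ (N * (q + 1)) averaging ⟩
  N * (q + 1) + d                    ≡⟨ +-comm (N * (q + 1)) d ⟩
  d + N * (q + 1)                    ∎
  where
    N : ℕ
    N = suc n
    basisIn : Fin N → ℕ
    basisIn i = count (λ j → CoronaDistances.inCopy G H i (S j))
    i₀ : Fin N
    i₀ = proj₁ (argmin basisIn)
    open CoronaLabelling G H fG fG-resolving S S-distinct S-resolving i₀
    averaging : N * basisInCopy ≤ d
    averaging =
      ≤-trans (∑-≥-const basisIn (proj₂ (argmin basisIn))) (copies-share-basis G H S)
    open ≤-Reasoning
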